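{- For every integer $n\ge 3$, the number of even parity alternating permutations (PAPs) of $[n]=\{1,\dots,n\}$ equals the number of odd PAPs of $[n]$, i.e. $p_n^e=p_n^o$.
   Context: A permutation $\sigma$ of $[n]$, written in one-line notation, is a PAP if its entries alternate in parity and $\sigma(1)$ is odd; equivalently, $\sigma(i)\equiv i \pmod 2$ for all $i$. A permutation is even or odd according to its sign $(-1)^{n-c}$, where $c$ is its number of cycles (fixed points included). $p_n^e$ and $p_n^o$ denote the numbers of even and odd PAPs of $[n]$. -}

module Defs where

open import Data.Nat using (ℕ; zero; suc; _∸_; _<ᵇ_)
open import Data.Nat.Properties using (_≟_)
open import Data.Bool using (Bool; true; false; _∧_; not; if_then_else_)
open import Data.Fin using (Fin; toℕ)
import Data.Fin.Properties as FinP
open import Data.List using (List; []; _∷_; map; concatMap; filter; length; allFin)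
open import Data.Bool.ListAction using (and)
open import Data.Vec using (Vec; lookup)
import Data.Vec as Vec
open import Data.Nat using (_%_)
open import Relation.Nullary.Decidable using (⌊_⌋)

all : {A : Set} → (A → Bool) → List A → Bool
all p xs = and (map p xs)

-- A map [n] → [n] in one-line notation: the vector (σ(1), …, σ(n)).
-- We index [n] by Fin n, where the element k : Fin n stands for k+1 ∈ [n].

allVecs : {A : Set} → List A → (m : ℕ) → List (Vec A m)
allVecs xs zero    = Vec.[] ∷ []
allVecs xs (suc m) = concatMap (λ x → map (x Vec.∷_) (allVecs xs m)) xs

isPerm : {n : ℕ} → Vec (Fin n) n → Bool
isPerm {n} σ =
  all (λ i → all (λ j → not ⌊ lookup σ i FinP.≟ lookup σ j ⌋ Data.Bool.∨ ⌊ i FinP.≟ j ⌋)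
                 (allFin n))
      (allFin n)
  where import Data.Bool

perms : (n : ℕ) → List (Vec (Fin n) n)
perms n = filter (λ σ → Data.Bool._≟_ (isPerm σ) true) (allVecs (allFin n) n)
  where import Data.Bool

-- Parity alternating: σ(i) ≡ i (mod 2) for all i (equivalently entries alternate
-- in parity and σ(1) is odd). Since k : Fin n stands for k+1, the shift cancels.
isPAP : {n : ℕ} → Vec (Fin n) n → Bool
isPAP {n} σ = all (λ i → ⌊ toℕ (lookup σ i) % 2 ≟ toℕ i % 2 ⌋) (allFin n)

iter : {n : ℕ} → Vec (Fin n) n → ℕ → Fin n → Fin n
iter σ zero    i = i
iter σ (suc k) i = lookup σ (iter σ k i)

-- i is the least element of its cycle: σ^k(i) ≥ i for k = 1, …, n
-- (every element of the cycle of i is σ^k(i) for some 1 ≤ k ≤ n).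
isCycleMin : {n : ℕ} → Vec (Fin n) n → Fin n → Bool
isCycleMin {n} σ i = all (λ k → not (toℕ (iter σ (suc (toℕ k)) i) <ᵇ toℕ i)) (allFin n)

-- Number of cycles (fixed points included): one least element per cycle.
cycles : {n : ℕ} → Vec (Fin n) n → ℕ
cycles {n} σ = length (filter (λ i → Data.Bool._≟_ (isCycleMin σ i) true) (allFin n))
  where import Data.Bool

-- σ is even iff its sign (-1)^(n - c) is +1, i.e. n - c is even.
isEven : {n : ℕ} → Vec (Fin n) n → Bool
isEven {n} σ = ⌊ (n ∸ cycles σ) % 2 ≟ 0 ⌋

pe : ℕ → ℕ
pe n = length (filter (λ σ → Data.Bool._≟_ (isPAP σ ∧ isEven σ) true) (perms n))
  where import Data.Bool

po : ℕ → ℕ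
po n = length (filter (λ σ → Data.Bool._≟_ (isPAP σ ∧ not (isEven σ)) true) (perms n))
  where import Data.Bool

{-# OPTIONS --safe #-}
-- The map σ ↦ (1 3) ∘ σ is an involution on the parity alternating permutations of [n], since
-- the transposition (1 3) preserves parity, and it changes the number of cycles by exactly one,
-- so it exchanges even and odd PAPs.  Count cycles by their least elements: all entries of the
-- cycle of a PAP through 3 are odd, so 3 is least on it exactly when 1 is not on it, and
-- composing with (1 3) merges the cycles of 1 and 3 if they differ and splits them otherwise.
-- Cycles avoiding 1 and 3 are unchanged and 1 is always a least element, so only 3 changes status.

module Submission where

open import Defs
open import Data.Bool using (Bool; true; false; not; _∧_; _∨_; if_then_else_; T)
import Data.Bool as Bool
open import Data.Bool.ListAction using (and)
open import Data.Bool.Properties using (T-≡; ⇔→≡; ¬-not; not-involutive)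
open import Data.Empty using (⊥-elim)
open import Data.Fin using (Fin; zero; suc; toℕ; fromℕ<)
open import Data.Fin.Patterns using (0F; 1F; 2F)
import Data.Fin.Properties as Fin
open import Data.List using (List; []; _∷_; _++_; map; filter; length; concatMap; tabulate; allFin)
open import Data.List.Properties using (length-++; filter-++; filter-≐; length-filter; length-tabulate; map-cong; map-∘; map-tabulate)
open import Data.List.Relation.Binary.Permutation.Propositional using (_↭_; ↭-reflexive)
import Data.List.Relation.Binary.Permutation.Propositional as ↭
open import Data.List.Relation.Binary.Permutation.Propositional.Properties using (map⁺)
open import Data.Nat using (ℕ; zero; suc; _+_; _∸_; _≤_; _<_; _%_; _<ᵇ_; z≤n; s≤s; s≤s⁻¹)
open import Data.Nat.ListAction using (sum)
open import Data.Nat.ListAction.Properties using (sum-↭)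
import Data.Nat.Properties as ℕ
open import Data.Product using (∃; _×_; _,_)
open import Data.Sum using (_⊎_; inj₁; inj₂)
open import Data.Unit using (tt)
open import Data.Vec using (Vec; lookup)
import Data.Vec as Vec
open import Data.Vec.Properties using (lookup-map)
open import Function using (_∘_; id; _⇔_; mk⇔; Equivalence)
open import Function.Definitions using (Injective)
open import Relation.Binary.PropositionalEquality using (_≡_; refl; sym; trans; cong; cong₂; subst; _≢_; module ≡-Reasoning)
open import Relation.Nullary using (Dec; yes; no; ¬_)
open import Relation.Nullary.Decidable using (⌊_⌋; toWitness; _⊎-dec_)
open import Relation.Unary using (Decidable)

open Equivalence using (to; from)
open ≡-Reasoning

private
  variable
    A B : Set

count : (A → Bool) → List A → ℕ
count p xs = length (filter (λ x → p x Bool.≟ true) xs)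

count-cong : {p q : A → Bool} → (∀ x → p x ≡ q x) → ∀ xs → count p xs ≡ count q xs
count-cong p≗q xs = cong length (filter-≐ _ _ ((λ {x} e → trans (sym (p≗q x)) e) , (λ {x} e → trans (p≗q x) e)) xs)

count-map : (p : B → Bool) (f : A → B) (xs : List A) → count p (map f xs) ≡ count (p ∘ f) xs
count-map p f [] = refl
count-map p f (x ∷ xs) with p (f x)
... | true  = cong suc (count-map p f xs)
... | false = count-map p f xs

count-++ : (p : A → Bool) (xs ys : List A) → count p (xs ++ ys) ≡ count p xs + count p ys
count-++ p xs ys = trans (cong length (filter-++ _ xs ys)) (length-++ (filter _ xs))

count-concatMap : (p : B → Bool) (g : A → List B) (xs : List A) →
                  count p (concatMap g xs) ≡ sum (map (count p ∘ g) xs)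
count-concatMap p g [] = refl
count-concatMap p g (x ∷ xs) = trans (count-++ p (g x) (concatMap g xs)) (cong (count p (g x) +_) (count-concatMap p g xs))

count-filter : (p q : A → Bool) (xs : List A) →
               count q (filter (λ x → p x Bool.≟ true) xs) ≡ count (λ x → p x ∧ q x) xs
count-filter p q [] = refl
count-filter p q (x ∷ xs) with p x
... | false = count-filter p q xs
... | true with q x
...   | true  = cong suc (count-filter p q xs)
...   | false = count-filter p q xs

count-allVecs-suc : (xs : List A) (m : ℕ) (c : Vec A (suc m) → Bool) →
                    count c (allVecs xs (suc m)) ≡ sum (map (λ x → count (c ∘ (x Vec.∷_)) (allVecs xs m)) xs)
count-allVecs-suc xs m c = trans (count-concatMap c (λ x → map (x Vec.∷_) (allVecs xs m)) xs)
                                 (cong sum (map-cong (λ x → count-map c (x Vec.∷_) (allVecs xs m)) xs))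

count-allVecs-map : (f : A → A) {xs : List A} → map f xs ↭ xs → (m : ℕ) (c : Vec A m → Bool) →
                    count c (allVecs xs m) ≡ count (c ∘ Vec.map f) (allVecs xs m)
count-allVecs-map f fxs↭xs zero c with c Vec.[]
... | true  = refl
... | false = refl
count-allVecs-map {A = A} f {xs} fxs↭xs (suc m) c = begin
  count c (allVecs xs (suc m))                                ≡⟨ count-allVecs-suc xs m c ⟩
  sum (map g xs)                                              ≡⟨ sum-↭ (map⁺ g fxs↭xs) ⟨
  sum (map g (map f xs))                                      ≡⟨ cong sum (map-∘ xs) ⟨
  sum (map (λ x → count (c ∘ (f x Vec.∷_)) (allVecs xs m)) xs) ≡⟨ cong sum (map-cong (λ x → count-allVecs-map f fxs↭xs m (c ∘ (f x Vec.∷_))) xs) ⟩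
  sum (map (λ x → count (c ∘ Vec.map f ∘ (x Vec.∷_)) (allVecs xs m)) xs) ≡⟨ count-allVecs-suc xs m (c ∘ Vec.map f) ⟨
  count (c ∘ Vec.map f) (allVecs xs (suc m))                  ∎
  where
    g : A → ℕ
    g x = count (c ∘ (x Vec.∷_)) (allVecs xs m)

count-tabulate : {n : ℕ} (p : A → Bool) (f : Fin n → A) → count p (tabulate f) ≡ count (p ∘ f) (allFin n)
count-tabulate p f = trans (cong (count p) (sym (map-tabulate id f))) (count-map p f (allFin _))

count-allFin-suc : {n : ℕ} (p : Fin (suc n) → Bool) →
                   count p (allFin (suc n)) ≡ (if p zero then suc (count (p ∘ suc) (allFin n)) else count (p ∘ suc) (allFin n))
count-allFin-suc p with p zero
... | true  = cong suc (count-tabulate p suc)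
... | false = count-tabulate p suc

count-allFin-flip : {n : ℕ} (p q : Fin n → Bool) (j : Fin n) → (∀ i → i ≢ j → q i ≡ p i) → q j ≡ not (p j) →
                    count q (allFin n) ≡ suc (count p (allFin n)) ⊎ count p (allFin n) ≡ suc (count q (allFin n))
count-allFin-flip {suc n} p q zero agree flip
  rewrite count-allFin-suc p | count-allFin-suc q | flip
        | count-cong (λ i → agree (suc i) λ ()) (allFin n)
  with p zero
... | true  = inj₂ refl
... | false = inj₁ refl
count-allFin-flip {suc n} p q (suc j) agree flip
  rewrite count-allFin-suc p | count-allFin-suc q | agree zero (λ ())
  with p zero | count-allFin-flip (p ∘ suc) (q ∘ suc) j (λ i i≢j → agree (suc i) (i≢j ∘ Fin.suc-injective)) flip
... | true  | inj₁ e = inj₁ (cong suc e)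
... | true  | inj₂ e = inj₂ (cong suc e)
... | false | r      = r

all-tabulate⇔ : {n : ℕ} (p : A → Bool) (f : Fin n → A) → all p (tabulate f) ≡ true ⇔ (∀ i → p (f i) ≡ true)
all-tabulate⇔ {n = zero} p f = mk⇔ (λ _ ()) (λ _ → refl)
all-tabulate⇔ {n = suc n} p f with p (f zero) in e
... | true  = mk⇔ (λ h → λ { zero → e ; (suc i) → to (all-tabulate⇔ p (f ∘ suc)) h i })
                  (λ h → from (all-tabulate⇔ p (f ∘ suc)) (h ∘ suc))
... | false = mk⇔ (λ ()) (λ h → ⊥-elim (false≢true (trans (sym e) (h zero))))
  where
    false≢true : false ≢ true
    false≢true ()

all-cong : {p q : A → Bool} → (∀ x → p x ≡ q x) → ∀ xs → all p xs ≡ all q xs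
all-cong p≗q xs = cong and (map-cong p≗q xs)

∧-∧-cong : ∀ {a b x y} → (a ≡ true → b ≡ true → x ≡ y) → a ∧ (b ∧ x) ≡ a ∧ (b ∧ y)
∧-∧-cong {true}  {true}  x≡y = x≡y refl refl
∧-∧-cong {true}  {false} _   = refl
∧-∧-cong {false}         _   = refl

does-→ : (a? : Dec A) (b? : Dec B) → not ⌊ a? ⌋ ∨ ⌊ b? ⌋ ≡ true → A → B
does-→ (yes _) (yes b) _  _ = b
does-→ (yes _) (no _)  () _
does-→ (no ¬a) _       _  a = ⊥-elim (¬a a)

not-<ᵇ⇔≥ : ∀ m n → not (m <ᵇ n) ≡ true ⇔ n ≤ m
not-<ᵇ⇔≥ m n with m <ᵇ n in e
... | true  = mk⇔ (λ ()) (λ n≤m → ⊥-elim (ℕ.<⇒≱ (ℕ.<ᵇ⇒< m n (subst T (sym e) tt)) n≤m))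
... | false = mk⇔ (λ _ → ℕ.≮⇒≥ (λ m<n → subst T e (ℕ.<⇒<ᵇ m<n))) (λ _ → refl)

least-witness : {P : ℕ → Set} → Decidable P → ∀ {p} → P p → ∃ λ a → a ≤ p × P a × (∀ j → j < a → ¬ P j)
least-witness P? {zero} Pp = 0 , z≤n , Pp , λ _ ()
least-witness P? {suc p} Pp with P? 0
... | yes P0 = 0 , z≤n , P0 , λ _ ()
... | no ¬P0 with least-witness (P? ∘ suc) Pp
... | a , a≤p , Pa , below = suc a , s≤s a≤p , Pa , λ { zero _ → ¬P0 ; (suc j) (s≤s j<a) → below j j<a }

even? : ℕ → Bool
even? m = ⌊ m % 2 ℕ.≟ 0 ⌋

even?-suc : ∀ m → even? (suc m) ≡ not (even? m)
even?-suc zero          = refl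
even?-suc (suc zero)    = refl
even?-suc (suc (suc m)) = even?-suc m

even?-∸-flip : ∀ {n c c'} → c ≤ n → c' ≤ n → c' ≡ suc c ⊎ c ≡ suc c' → even? (n ∸ c') ≡ not (even? (n ∸ c))
even?-∸-flip {n} {c} _ c'≤n (inj₁ refl) = begin
  even? (n ∸ suc c)             ≡⟨ not-involutive _ ⟨
  not (not (even? (n ∸ suc c))) ≡⟨ cong not (even?-suc (n ∸ suc c)) ⟨
  not (even? (suc (n ∸ suc c))) ≡⟨ cong (not ∘ even?) (ℕ.+-∸-assoc 1 c'≤n) ⟨
  not (even? (n ∸ c))           ∎
even?-∸-flip {n} {c' = c'} c≤n _ (inj₂ refl) = trans (cong even? (ℕ.+-∸-assoc 1 c≤n)) (even?-suc (n ∸ suc c'))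

PreservesParity : {n : ℕ} → (Fin n → Fin n) → Set
PreservesParity f = ∀ x → toℕ (f x) % 2 ≡ toℕ x % 2

even-≢0F⇒2≤ : {n : ℕ} (x : Fin (suc n)) → toℕ x % 2 ≡ 0 → x ≢ 0F → 2 ≤ toℕ x
even-≢0F⇒2≤ zero                _  x≢0 = ⊥-elim (x≢0 refl)
even-≢0F⇒2≤ (suc zero)          ()
even-≢0F⇒2≤ (suc (suc x))       _  _   = s≤s (s≤s z≤n)

module _ {n : ℕ} (ρ : Vec (Fin n) n) where

  iter-+ : ∀ a d x → iter ρ (a + d) x ≡ iter ρ a (iter ρ d x)
  iter-+ zero    d x = refl
  iter-+ (suc a) d x = cong (lookup ρ) (iter-+ a d x)

  iter-injective : Injective _≡_ _≡_ (lookup ρ) → ∀ m {x y} → iter ρ m x ≡ iter ρ m y → x ≡ y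
  iter-injective inj zero    e = e
  iter-injective inj (suc m) e = iter-injective inj m (inj e)

  iter-parity : PreservesParity (lookup ρ) → ∀ m → PreservesParity (iter ρ m)
  iter-parity par zero    x = refl
  iter-parity par (suc m) x = trans (par _) (iter-parity par m x)

  -- Pigeonhole on x, ρ x, …, ρⁿ x, then cancel the common prefix by injectivity.
  iter-returns : Injective _≡_ _≡_ (lookup ρ) → ∀ x → ∃ λ p → p < n × iter ρ (suc p) x ≡ x
  iter-returns inj x with Fin.pigeonhole (ℕ.n<1+n n) (λ (m : Fin (suc n)) → iter ρ (toℕ m) x)
  ... | i , j , i<j , ρⁱx≡ρʲx with ℕ.m≤n⇒∃[o]m+o≡n i<j
  ... | p , 1+i+p≡j = p , p<n , iter-injective inj (toℕ i) ρⁱρ¹⁺ᵖx≡ρⁱx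
    where
      i+1+p≡j : toℕ i + suc p ≡ toℕ j
      i+1+p≡j = trans (ℕ.+-suc (toℕ i) p) 1+i+p≡j
      p<n : p < n
      p<n = ℕ.≤-trans (s≤s (ℕ.m≤n+m p (toℕ i))) (ℕ.≤-trans (ℕ.≤-reflexive 1+i+p≡j) (s≤s⁻¹ (Fin.toℕ<n j)))
      ρⁱρ¹⁺ᵖx≡ρⁱx : iter ρ (toℕ i) (iter ρ (suc p) x) ≡ iter ρ (toℕ i) x
      ρⁱρ¹⁺ᵖx≡ρⁱx = begin
        iter ρ (toℕ i) (iter ρ (suc p) x) ≡⟨ iter-+ (toℕ i) (suc p) x ⟨
        iter ρ (toℕ i + suc p) x          ≡⟨ cong (λ m → iter ρ m x) i+1+p≡j ⟩
        iter ρ (toℕ j) x                  ≡⟨ ρⁱx≡ρʲx ⟨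
        iter ρ (toℕ i) x                  ∎

  iter-periodic : ∀ {p x} → iter ρ (suc p) x ≡ x → ∀ m → ∃ λ r → r ≤ p × iter ρ m x ≡ iter ρ r x
  iter-periodic ret zero = zero , z≤n , refl
  iter-periodic {p} ret (suc m) with iter-periodic ret m
  ... | r , r≤p , e with ℕ.m≤n⇒m<n∨m≡n r≤p
  ... | inj₁ r<p  = suc r , r<p , cong (lookup ρ) e
  ... | inj₂ refl = zero , z≤n , trans (cong (lookup ρ) e) ret

  isCycleMin⇔ : (i : Fin n) → isCycleMin ρ i ≡ true ⇔ (∀ k → k < n → toℕ i ≤ toℕ (iter ρ (suc k) i))
  isCycleMin⇔ i = mk⇔ ⇒ ⇐
    where
      ⇒ : isCycleMin ρ i ≡ true → ∀ k → k < n → toℕ i ≤ toℕ (iter ρ (suc k) i)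
      ⇒ min k k<n = to (not-<ᵇ⇔≥ _ _)
        (subst (λ m → not (toℕ (iter ρ (suc m) i) <ᵇ toℕ i) ≡ true) (Fin.toℕ-fromℕ< k<n)
               (to (all-tabulate⇔ _ id) min (fromℕ< k<n)))
      ⇐ : (∀ k → k < n → toℕ i ≤ toℕ (iter ρ (suc k) i)) → isCycleMin ρ i ≡ true
      ⇐ above = from (all-tabulate⇔ _ id) (λ k → from (not-<ᵇ⇔≥ _ _) (above (toℕ k) (Fin.toℕ<n k)))

  isCycleMin-false : ∀ {i k} → k < n → toℕ (iter ρ (suc k) i) < toℕ i → isCycleMin ρ i ≡ false
  isCycleMin-false {i} {k} k<n smaller = ¬-not (λ min → ℕ.<⇒≱ smaller (to (isCycleMin⇔ i) min k k<n))

  isCycleMin-of-return : ∀ {i p} → iter ρ (suc p) i ≡ i → (∀ r → r ≤ p → toℕ i ≤ toℕ (iter ρ r i)) →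
                         isCycleMin ρ i ≡ true
  isCycleMin-of-return {i} ret above = from (isCycleMin⇔ i) λ k _ →
    let r , r≤p , e = iter-periodic ret (suc k) in subst (λ y → toℕ i ≤ toℕ y) (sym e) (above r r≤p)

  cycles≤n : cycles ρ ≤ n
  cycles≤n = ℕ.≤-trans (length-filter _ (allFin n)) (ℕ.≤-reflexive (length-tabulate id))

isCycleMin-cong : {n : ℕ} (ρ σ : Vec (Fin n) n) (i : Fin n) → (∀ k → k < n → iter ρ (suc k) i ≡ iter σ (suc k) i) →
                  isCycleMin ρ i ≡ isCycleMin σ i
isCycleMin-cong {n} ρ σ i same = all-cong (λ k → cong (λ y → not (toℕ y <ᵇ toℕ i)) (same (toℕ k) (Fin.toℕ<n k))) (allFin n)

isCycleMin-0F : {n : ℕ} (ρ : Vec (Fin (suc n)) (suc n)) → isCycleMin ρ 0F ≡ true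
isCycleMin-0F ρ = from (isCycleMin⇔ ρ 0F) (λ _ _ → z≤n)

iter-agree : {n : ℕ} (f : Fin n → Fin n) (ρ ρ' : Vec (Fin n) n) → (∀ x → lookup ρ' x ≡ f (lookup ρ x)) →
             ∀ m i → (∀ j → j < m → f (iter ρ (suc j) i) ≡ iter ρ (suc j) i) → iter ρ' m i ≡ iter ρ m i
iter-agree f ρ ρ' ρ'≡fρ zero    i fixed = refl
iter-agree f ρ ρ' ρ'≡fρ (suc m) i fixed = begin
  lookup ρ' (iter ρ' m i) ≡⟨ cong (lookup ρ') (iter-agree f ρ ρ' ρ'≡fρ m i (λ j j<m → fixed j (ℕ.m<n⇒m<1+n j<m))) ⟩
  lookup ρ' (iter ρ m i)  ≡⟨ ρ'≡fρ _ ⟩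
  f (iter ρ (suc m) i)    ≡⟨ fixed m (ℕ.n<1+n m) ⟩
  iter ρ (suc m) i        ∎

isPerm⇒injective : {n : ℕ} (σ : Vec (Fin n) n) → isPerm σ ≡ true → Injective _≡_ _≡_ (lookup σ)
isPerm⇒injective σ perm {x} {y} =
  does-→ (lookup σ x Fin.≟ lookup σ y) (x Fin.≟ y) (to (all-tabulate⇔ _ id) (to (all-tabulate⇔ _ id) perm x) y)

isPAP⇒parity : {n : ℕ} (σ : Vec (Fin n) n) → isPAP σ ≡ true → PreservesParity (lookup σ)
isPAP⇒parity σ pap x =
  toWitness {a? = toℕ (lookup σ x) % 2 ℕ.≟ toℕ x % 2} (from T-≡ (to (all-tabulate⇔ _ id) pap x))

≟-injective : {n : ℕ} {f : Fin n → Fin n} → Injective _≡_ _≡_ f → ∀ a b → ⌊ f a Fin.≟ f b ⌋ ≡ ⌊ a Fin.≟ b ⌋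
≟-injective {f = f} inj a b with a Fin.≟ b | f a Fin.≟ f b
... | yes _    | yes _     = refl
... | no  _    | no  _     = refl
... | yes refl | no  fa≢fa = ⊥-elim (fa≢fa refl)
... | no  a≢b  | yes fa≡fb = ⊥-elim (a≢b (inj fa≡fb))

isPerm-map : {n : ℕ} {f : Fin n → Fin n} → Injective _≡_ _≡_ f → (σ : Vec (Fin n) n) → isPerm (Vec.map f σ) ≡ isPerm σ
isPerm-map {n} {f} inj σ = all-cong (λ i → all-cong (λ j → cong (λ b → not b ∨ ⌊ i Fin.≟ j ⌋) (begin
  ⌊ lookup (Vec.map f σ) i Fin.≟ lookup (Vec.map f σ) j ⌋ ≡⟨ cong₂ (λ a b → ⌊ a Fin.≟ b ⌋) (lookup-map i f σ) (lookup-map j f σ) ⟩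
  ⌊ f (lookup σ i) Fin.≟ f (lookup σ j) ⌋                 ≡⟨ ≟-injective inj _ _ ⟩
  ⌊ lookup σ i Fin.≟ lookup σ j ⌋                         ∎)) (allFin n)) (allFin n)

isPAP-map : {n : ℕ} {f : Fin n → Fin n} → PreservesParity f → (σ : Vec (Fin n) n) → isPAP (Vec.map f σ) ≡ isPAP σ
isPAP-map {n} {f} par σ = all-cong (λ i → cong (λ v → ⌊ v ℕ.≟ toℕ i % 2 ⌋)
  (trans (cong (λ y → toℕ y % 2) (lookup-map i f σ)) (par (lookup σ i)))) (allFin n)

module _ {k : ℕ} where

  -- The transposition (1 3) of [3 + k], as Fin index i stands for i + 1.
  swap₀₂ : Fin (3 + k) → Fin (3 + k)
  swap₀₂ 0F = 2F
  swap₀₂ 1F = 1F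
  swap₀₂ 2F = 0F
  swap₀₂ (suc (suc (suc x))) = suc (suc (suc x))

  swap₀₂-involutive : ∀ x → swap₀₂ (swap₀₂ x) ≡ x
  swap₀₂-involutive 0F = refl
  swap₀₂-involutive 1F = refl
  swap₀₂-involutive 2F = refl
  swap₀₂-involutive (suc (suc (suc x))) = refl

  swap₀₂-injective : Injective _≡_ _≡_ swap₀₂
  swap₀₂-injective {x} {y} e = trans (sym (swap₀₂-involutive x)) (trans (cong swap₀₂ e) (swap₀₂-involutive y))

  swap₀₂-parity : PreservesParity swap₀₂
  swap₀₂-parity 0F = refl
  swap₀₂-parity 1F = refl
  swap₀₂-parity 2F = refl
  swap₀₂-parity (suc (suc (suc x))) = refl

  swap₀₂-fixes : ∀ {x} → ¬ (x ≡ 0F ⊎ x ≡ 2F) → swap₀₂ x ≡ x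
  swap₀₂-fixes {0F} moved = ⊥-elim (moved (inj₁ refl))
  swap₀₂-fixes {1F} _ = refl
  swap₀₂-fixes {2F} moved = ⊥-elim (moved (inj₂ refl))
  swap₀₂-fixes {suc (suc (suc x))} _ = refl

  swap₀₂-fixes-odd : ∀ {x} → toℕ x % 2 ≡ 1 → swap₀₂ x ≡ x
  swap₀₂-fixes-odd odd = swap₀₂-fixes λ { (inj₁ refl) → case odd ; (inj₂ refl) → case odd }
    where
      case : 0 ≢ 1
      case ()

  swap₀₂-fixes-≥3 : ∀ {x} → 3 ≤ toℕ x → swap₀₂ x ≡ x
  swap₀₂-fixes-≥3 {1F} (s≤s ())
  swap₀₂-fixes-≥3 {2F} (s≤s (s≤s ()))
  swap₀₂-fixes-≥3 {suc (suc (suc x))} _ = refl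

  swap₀₂-permutes : map swap₀₂ (allFin (3 + k)) ↭ allFin (3 + k)
  swap₀₂-permutes = ↭.trans (↭-reflexive (cong (λ xs → 2F ∷ 1F ∷ 0F ∷ xs) (map-tabulate _ swap₀₂)))
    (↭.trans (↭.swap 2F 1F ↭.refl) (↭.trans (↭.prep 1F (↭.swap 2F 0F ↭.refl)) (↭.swap 1F 0F ↭.refl)))

  SwappedBy : (ρ ρ' : Vec (Fin (3 + k)) (3 + k)) → Set
  SwappedBy ρ ρ' = ∀ x → lookup ρ' x ≡ swap₀₂ (lookup ρ x)

  module _ (ρ ρ' : Vec (Fin (3 + k)) (3 + k)) (ρ↦ρ' : SwappedBy ρ ρ') where

    isCycleMin-swap-≥3 : ∀ i → 3 ≤ toℕ i → isCycleMin ρ i ≡ true → isCycleMin ρ' i ≡ true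
    isCycleMin-swap-≥3 i 3≤i min = trans (isCycleMin-cong ρ' ρ i agree) min
      where
        agree : ∀ m → m < 3 + k → iter ρ' (suc m) i ≡ iter ρ (suc m) i
        agree m m<n = iter-agree swap₀₂ ρ ρ' ρ↦ρ' (suc m) i λ j j<1+m →
          swap₀₂-fixes-≥3 (ℕ.≤-trans 3≤i (to (isCycleMin⇔ ρ i) min j (ℕ.<-≤-trans j<1+m m<n)))

    isCycleMin-swap-1F : PreservesParity (lookup ρ) → isCycleMin ρ' 1F ≡ isCycleMin ρ 1F
    isCycleMin-swap-1F par = isCycleMin-cong ρ' ρ 1F λ m _ →
      iter-agree swap₀₂ ρ ρ' ρ↦ρ' (suc m) 1F (λ j _ → swap₀₂-fixes-odd (iter-parity ρ par (suc j) 1F))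

    -- Follow the orbit of 3 under ρ to its first visit a + 1 steps later to 1 or 3; up to there ρ'
    -- agrees with ρ.  If the orbit returns to 3, then 1 is not on ρ's cycle of 3, while ρ' sends it
    -- to 1 instead.  If it reaches 1, then ρ' sends it back to 3, closing a cycle that avoids 1.
    isCycleMin-swap-2F : Injective _≡_ _≡_ (lookup ρ) → PreservesParity (lookup ρ) →
                         isCycleMin ρ' 2F ≡ not (isCycleMin ρ 2F)
    isCycleMin-swap-2F inj par with iter-returns ρ inj 2F
    ... | p , p<n , ret with least-witness (λ j → (iter ρ (suc j) 2F Fin.≟ 0F) ⊎-dec (iter ρ (suc j) 2F Fin.≟ 2F)) (inj₂ ret)
    ... | a , a≤p , hit , unmoved = result hit
      where
        a<n : a < 3 + k
        a<n = ℕ.≤-<-trans a≤p p<n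
        agree : ∀ r → r ≤ a → iter ρ' r 2F ≡ iter ρ r 2F
        agree r r≤a = iter-agree swap₀₂ ρ ρ' ρ↦ρ' r 2F (λ j j<r → swap₀₂-fixes (unmoved j (ℕ.<-≤-trans j<r r≤a)))
        step : iter ρ' (suc a) 2F ≡ swap₀₂ (iter ρ (suc a) 2F)
        step = trans (ρ↦ρ' _) (cong (swap₀₂ ∘ lookup ρ) (agree a ℕ.≤-refl))
        2≤ : ∀ r → r ≤ a → 2 ≤ toℕ (iter ρ r 2F)
        2≤ zero    _   = ℕ.≤-refl
        2≤ (suc j) j<a = even-≢0F⇒2≤ _ (iter-parity ρ par (suc j) 2F) (λ e → unmoved j j<a (inj₁ e))
        result : iter ρ (suc a) 2F ≡ 0F ⊎ iter ρ (suc a) 2F ≡ 2F → isCycleMin ρ' 2F ≡ not (isCycleMin ρ 2F)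
        result (inj₂ returns) = begin
          isCycleMin ρ' 2F       ≡⟨ isCycleMin-false ρ' a<n (subst (λ y → toℕ y < 2) (sym (trans step (cong swap₀₂ returns))) (s≤s z≤n)) ⟩
          false                  ≡⟨ cong not (isCycleMin-of-return ρ returns 2≤) ⟨
          not (isCycleMin ρ 2F)  ∎
        result (inj₁ meets0) = begin
          isCycleMin ρ' 2F       ≡⟨ isCycleMin-of-return ρ' (trans step (cong swap₀₂ meets0))
                                      (λ r r≤a → subst (λ y → 2 ≤ toℕ y) (sym (agree r r≤a)) (2≤ r r≤a)) ⟩
          true                   ≡⟨ cong not (isCycleMin-false ρ a<n (subst (λ y → toℕ y < 2) (sym meets0) (s≤s z≤n))) ⟨
          not (isCycleMin ρ 2F)  ∎

  module _ (σ : Vec (Fin (3 + k)) (3 + k)) (inj : Injective _≡_ _≡_ (lookup σ)) (par : PreservesParity (lookup σ)) where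

    private
      σ' : Vec (Fin (3 + k)) (3 + k)
      σ' = Vec.map swap₀₂ σ

      σ↦σ' : SwappedBy σ σ'
      σ↦σ' x = lookup-map x swap₀₂ σ

      σ'↦σ : SwappedBy σ' σ
      σ'↦σ x = sym (trans (cong swap₀₂ (σ↦σ' x)) (swap₀₂-involutive _))

    isCycleMin-swap : ∀ i → i ≢ 2F → isCycleMin σ' i ≡ isCycleMin σ i
    isCycleMin-swap 0F _ = trans (isCycleMin-0F σ') (sym (isCycleMin-0F σ))
    isCycleMin-swap 1F _ = isCycleMin-swap-1F σ σ' σ↦σ' par
    isCycleMin-swap 2F i≢2 = ⊥-elim (i≢2 refl)
    isCycleMin-swap i@(suc (suc (suc _))) _ =
      ⇔→≡ (mk⇔ (isCycleMin-swap-≥3 σ' σ σ'↦σ i 3≤i) (isCycleMin-swap-≥3 σ σ' σ↦σ' i 3≤i))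
      where
        3≤i : 3 ≤ toℕ i
        3≤i = s≤s (s≤s (s≤s z≤n))

    isEven-swap : isEven (Vec.map swap₀₂ σ) ≡ not (isEven σ)
    isEven-swap = even?-∸-flip (cycles≤n σ) (cycles≤n σ')
      (count-allFin-flip (isCycleMin σ) (isCycleMin σ') 2F isCycleMin-swap (isCycleMin-swap-2F σ σ' σ↦σ' inj par))

  swap-PAP-parity : (σ : Vec (Fin (3 + k)) (3 + k)) →
                    isPerm (Vec.map swap₀₂ σ) ∧ (isPAP (Vec.map swap₀₂ σ) ∧ isEven (Vec.map swap₀₂ σ))
                      ≡ isPerm σ ∧ (isPAP σ ∧ not (isEven σ))
  swap-PAP-parity σ = trans
    (cong₂ (λ a b → a ∧ (b ∧ isEven (Vec.map swap₀₂ σ))) (isPerm-map swap₀₂-injective σ) (isPAP-map swap₀₂-parity σ))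
    (∧-∧-cong λ perm pap → isEven-swap σ (isPerm⇒injective σ perm) (isPAP⇒parity σ pap))

proposition2 : (n : ℕ) → 3 ≤ n → pe n ≡ po n
proposition2 (suc (suc zero)) (s≤s (s≤s ()))
proposition2 (suc zero) (s≤s ())
proposition2 (suc (suc (suc k))) _ = begin
  pe (3 + k)                                                     ≡⟨ count-filter isPerm _ vecs ⟩
  count (λ σ → isPerm σ ∧ (isPAP σ ∧ isEven σ)) vecs             ≡⟨ count-allVecs-map swap₀₂ swap₀₂-permutes (3 + k) _ ⟩
  count (λ σ → isPerm (Vec.map swap₀₂ σ) ∧ (isPAP (Vec.map swap₀₂ σ) ∧ isEven (Vec.map swap₀₂ σ))) vecs
                                                                 ≡⟨ count-cong swap-PAP-parity vecs ⟩
  count (λ σ → isPerm σ ∧ (isPAP σ ∧ not (isEven σ))) vecs       ≡⟨ count-filter isPerm _ vecs ⟨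
  po (3 + k)                                                     ∎
  where
    vecs : List (Vec (Fin (3 + k)) (3 + k))
    vecs = allVecs (allFin (3 + k)) (3 + k)
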